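{- Let $G$ be a finite group with $d(G)=2$. Then either $G$ has a generating set $\{x,y\}$ with $|x|\geq 4$, or $G$ is isomorphic to one of $C_2^2$, $C_3^2$, $D_6$, $A_4$, $3_+^{1+2}$.
   Context: $d(G)$ is the smallest size of a generating set of $G$; $|x|$ is the order of $x$. $C_p^2$ is elementary abelian of order $p^2$, $D_6$ dihedral of order 6, $A_4$ alternating of degree 4, $3_+^{1+2}$ the nonabelian group of order 27 and exponent 3. -}

module Defs where

open import Level using (0ℓ)
open import Data.Nat using (ℕ; zero; suc; _≤_; _<_)
open import Data.Fin using (Fin; zero; suc)
open import Data.Product using (_×_; _,_; Σ; ∃; ∃-syntax)
open import Data.List using (List; []; _∷_; length)
open import Data.List.Membership.Propositional using (_∈_)
open import Relation.Binary.PropositionalEquality using (_≡_)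
open import Relation.Nullary using (¬_)
open import Algebra.Structures using (IsGroup)

-- Finite groups: every finite group of order n is isomorphic to a group
-- structure on Fin n with propositional equality.

record FinGroup (n : ℕ) : Set where
  field
    _∙_   : Fin n → Fin n → Fin n
    ε     : Fin n
    _⁻¹   : Fin n → Fin n
    isGroup : IsGroup _≡_ _∙_ ε _⁻¹
  infixl 7 _∙_
  infix 8 _⁻¹

module _ {n : ℕ} (G : FinGroup n) where
  open FinGroup G

  data ⟨_⟩ (S : List (Fin n)) : Fin n → Set where
    gen : ∀ {x} → x ∈ S → ⟨ S ⟩ x
    one : ⟨ S ⟩ ε
    mul : ∀ {x y} → ⟨ S ⟩ x → ⟨ S ⟩ y → ⟨ S ⟩ (x ∙ y)
    inv : ∀ {x} → ⟨ S ⟩ x → ⟨ S ⟩ (x ⁻¹)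

  Generates : List (Fin n) → Set
  Generates S = ∀ g → ⟨ S ⟩ g

  -- d(G) = k : G has a generating set of size k and none of smaller size
  -- (a set of size j is given as a list of length j).
  RankIs : ℕ → Set
  RankIs k = (∃[ S ] (length S ≡ k × Generates S))
           × (∀ S → length S < k → ¬ Generates S)

  pow : Fin n → ℕ → Fin n
  pow x zero = ε
  pow x (suc k) = x ∙ pow x k

  OrderIs : Fin n → ℕ → Set
  OrderIs x k = (1 ≤ k) × (pow x k ≡ ε)
              × (∀ j → 1 ≤ j → j < k → ¬ (pow x j ≡ ε))

record _≅_ {n : ℕ} (G : FinGroup n) {H : Set} (_⋆_ : H → H → H) : Set where
  open FinGroup G
  field
    to   : Fin n → H
    from : H → Fin n
    from∘to : ∀ g → from (to g) ≡ g
    to∘from : ∀ h → to (from h) ≡ h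
    hom  : ∀ a b → to (a ∙ b) ≡ to a ⋆ to b

_+₂_ : Fin 2 → Fin 2 → Fin 2
zero +₂ b = b
suc zero +₂ zero = suc zero
suc zero +₂ suc zero = zero

_+₃_ : Fin 3 → Fin 3 → Fin 3
zero +₃ b = b
suc zero +₃ zero = suc zero
suc zero +₃ suc zero = suc (suc zero)
suc zero +₃ suc (suc zero) = zero
suc (suc zero) +₃ zero = suc (suc zero)
suc (suc zero) +₃ suc zero = zero
suc (suc zero) +₃ suc (suc zero) = suc zero

_*₃_ : Fin 3 → Fin 3 → Fin 3
zero *₃ b = zero
suc zero *₃ b = b
suc (suc zero) *₃ b = b +₃ b

neg₃ : Fin 3 → Fin 3
neg₃ zero = zero
neg₃ (suc zero) = suc (suc zero)
neg₃ (suc (suc zero)) = suc zero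

C2² : Fin 2 × Fin 2 → Fin 2 × Fin 2 → Fin 2 × Fin 2
C2² (a , b) (c , d) = (a +₂ c , b +₂ d)

C3² : Fin 3 × Fin 3 → Fin 3 × Fin 3 → Fin 3 × Fin 3
C3² (a , b) (c , d) = (a +₃ c , b +₃ d)

-- D₆ (dihedral of order 6) = ℤ/3 ⋊ ℤ/2, reflection acting by inversion:
-- (a , s)(b , t) = (a + (-1)^s b , s + t)
signAct : Fin 2 → Fin 3 → Fin 3
signAct zero b = b
signAct (suc zero) b = neg₃ b

D6 : Fin 3 × Fin 2 → Fin 3 × Fin 2 → Fin 3 × Fin 2
D6 (a , s) (b , t) = (a +₃ signAct s b , s +₂ t)

-- A₄ = C₂² ⋊ ℤ/3, generator of ℤ/3 acting by the order-3 automorphism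
-- σ(a , b) = (b , a + b) of C₂²:  (v , k)(w , l) = (v + σ^k w , k + l)
σ : Fin 2 × Fin 2 → Fin 2 × Fin 2
σ (a , b) = (b , a +₂ b)

σ^ : Fin 3 → Fin 2 × Fin 2 → Fin 2 × Fin 2
σ^ zero v = v
σ^ (suc zero) v = σ v
σ^ (suc (suc zero)) v = σ (σ v)

A4 : (Fin 2 × Fin 2) × Fin 3 → (Fin 2 × Fin 2) × Fin 3 → (Fin 2 × Fin 2) × Fin 3
A4 (v , k) (w , l) = (C2² v (σ^ k w) , k +₃ l)

-- 3₊^{1+2}: Heisenberg group over ℤ/3 (upper unitriangular 3×3 matrices),
-- (a , b , c)(a' , b' , c') = (a + a' , b + b' , c + c' + a b')
Heis3 : Fin 3 × Fin 3 × Fin 3 → Fin 3 × Fin 3 × Fin 3 → Fin 3 × Fin 3 × Fin 3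
Heis3 (a , b , c) (a' , b' , c') = (a +₃ a' , b +₃ b' , (c +₃ c') +₃ (a *₃ b'))

{-# OPTIONS --safe #-}
module Submission where

-- Let G = ⟨x, y⟩. Since d(G) = 2, none of x, y, xy is trivial, and (y, x), (xy, y) are again
-- generating pairs, so we are done unless x, y, xy all have order 2 or 3. Then G is a quotient
-- of the triangle group Δ(p, q, r) = ⟨a, b | aᵖ, bᵠ, (ab)ʳ⟩ with p, q, r ∈ {2, 3}, and the Nielsen
-- moves (x, y) ↦ (y, x) and (x, y) ↦ (xy, y⁻¹) permute (p, q, r), so we may sort it. The spherical
-- cases are finite: Δ(2,2,2) = C₂², Δ(2,2,3) = D₆, Δ(2,3,3) = A₄. For (3,3,3) consider the
-- generating pair (xy², y): order ≥ 4 finishes, order 2 gives type (2,3,3) since xy² · y = x, and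
-- order 3 makes G a quotient of ⟨a, b | a³, b³, (ab)³, (ab²)³⟩ = 3₊^{1+2}, or of C₃² when xy = yx.
-- Each quotient map H → G is built by von Dyck's theorem from a complete rewriting system for the
-- presentation of H, and it is injective because every nontrivial normal subgroup of H contains one
-- of a, b, ab, ab², [a, b], whose images x, y, xy, xy², [x, y] are nontrivial in G.

open import Defs
open import Data.Nat using (ℕ; _≤_)
open import Data.Fin using (Fin)
open import Data.Product using (_×_; _,_; ∃-syntax)
open import Data.Sum using (_⊎_)
open import Data.List using (_∷_; [])

open import Level using (0ℓ)
open import Algebra.Bundles using (Group)
open import Algebra.Structures using (IsGroup)
open import Data.Nat using (zero; suc; _+_; _∸_; _<_; z≤n; s≤s)
open import Data.Nat.Properties using (+-suc; +-identityʳ; m≤n⇒∃[o]m+o≡n; n<1+n; m<1+n⇒m<n∨m≡n; ≤-pred; ≤-refl)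
open import Data.Fin using (toℕ; _≟_; #_)
open import Data.Fin.Properties using (pigeonhole)
open import Data.List using (List; _++_; _∷ʳ_; length; take; drop; map; concat; replicate; find; allFin; cartesianProduct)
open import Data.List.Properties using (take++drop≡id)
import Data.List.Properties as List
open import Data.List.Membership.Propositional using (_∈_)
open import Data.List.Membership.Propositional.Properties using (∈-allFin; ∈-cartesianProduct⁺)
open import Data.List.Relation.Unary.All as All using (All; []; _∷_)
open import Data.List.Relation.Unary.All.Properties using (++⁺; map⁺)
open import Data.List.Relation.Unary.Any as Any using (Any; here; there)
open import Data.Maybe using (fromMaybe)
open import Data.Product using (Σ; proj₁; proj₂)
open import Data.Product.Properties using (≡-dec)
open import Data.Sum using (inj₁; inj₂)
open import Data.Unit using (⊤; tt)
open import Function using (_∘_)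
open import Relation.Binary using (DecidableEquality)
open import Relation.Binary.PropositionalEquality
open import Relation.Nullary using (¬_; Dec; yes; no; contradiction)
open import Relation.Nullary.Decidable using (True; toWitness; _×-dec_; _⊎-dec_; _→-dec_)
open import Relation.Unary using (Decidable)

data Letter : Set where
  A B : Letter

_≟ₗ_ : DecidableEquality Letter
A ≟ₗ A = yes refl
A ≟ₗ B = no λ ()
B ≟ₗ A = no λ ()
B ≟ₗ B = yes refl

Word : Set
Word = List Letter

_≟ʷ_ : DecidableEquality Word
_≟ʷ_ = List.≡-dec _≟ₗ_

a b : Word
a = A ∷ []
b = B ∷ []

infixr 6 _·_
infix 7 _^_

_·_ : Word → Word → Word
_·_ = _++_

_^_ : Word → ℕ → Word
w ^ k = concat (replicate k w)

Rule : Set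
Rule = Word × Word

rewritesAtHead : List Rule → Word → List Word
rewritesAtHead [] w = []
rewritesAtHead ((l , r) ∷ rs) w with take (length l) w ≟ʷ l
... | yes _ = (r ++ drop (length l) w) ∷ rewritesAtHead rs w
... | no _  = rewritesAtHead rs w

rewrites : List Rule → Word → List Word
rewrites rs []      = rewritesAtHead rs []
rewrites rs (c ∷ w) = rewritesAtHead rs (c ∷ w) ++ map (c ∷_) (rewrites rs w)

normaliseWithin : ℕ → List Rule → Word → Word
normaliseWithin zero    rs w = w
normaliseWithin (suc k) rs w with rewrites rs w
... | []     = w
... | w′ ∷ _ = normaliseWithin k rs w′

-- Any fuel is sound; 32 rewriting steps suffice for the presentations below.
normalise : List Rule → Word → Word
normalise = normaliseWithin 32

-- A rule l → r found by Knuth–Bendix completion is certified by a word w such that l and r are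
-- normal forms of w or of one-step rewrites of w.
Reduct : List Rule → Word → Word → Set
Reduct rs w v = Any (λ u → normalise rs u ≡ v) (w ∷ rewrites rs w)

Derives : List Rule → List (Rule × Word) → Set
Derives rs []                    = ⊤
Derives rs (((l , r) , w) ∷ ds) = (Reduct rs w l × Reduct rs w r) × Derives (rs ∷ʳ (l , r)) ds

derives? : ∀ rs ds → Dec (Derives rs ds)
derives? rs []                   = yes _
derives? rs (((l , r) , w) ∷ ds) =
  (reduct? l ×-dec reduct? r) ×-dec derives? (rs ∷ʳ (l , r)) ds
  where
  reduct? : ∀ v → Dec (Reduct rs w v)
  reduct? v = Any.any? (λ u → normalise rs u ≟ʷ v) (w ∷ rewrites rs w)

extend : List Rule → List (Rule × Word) → List Rule
extend rs []             = rs
extend rs ((lr , _) ∷ ds) = extend (rs ∷ʳ lr) ds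

module _ {P : ℕ → Set} (P? : Decidable P) where

  private
    searchFrom : ∀ k d → (∀ j → j < k → ¬ P j) → P (k + d) → ∃[ m ] (P m × ∀ j → j < m → ¬ P j)
    searchFrom k zero    below p = k , subst P (+-identityʳ k) p , below
    searchFrom k (suc d) below p with P? k
    ... | yes pk = k , pk , below
    ... | no ¬pk = searchFrom (suc k) d below′ (subst P (+-suc k d) p)
      where
      below′ : ∀ j → j < suc k → ¬ P j
      below′ j j<1+k with m<1+n⇒m<n∨m≡n j<1+k
      ... | inj₁ j<k  = below j j<k
      ... | inj₂ refl = ¬pk

  least-witness : ∀ {m} → P m → ∃[ k ] (P k × ∀ j → j < k → ¬ P j)
  least-witness {m} = searchFrom 0 m (λ _ ())

data SmallPrime : ℕ → Set where
  two   : SmallPrime 2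
  three : SmallPrime 3

module GroupTheory {n : ℕ} (G : FinGroup n) where
  open FinGroup G
  open IsGroup isGroup using (assoc; identityˡ; identityʳ; inverseˡ; inverseʳ)

  group : Group 0ℓ 0ℓ
  group = record { isGroup = isGroup }

  open import Algebra.Properties.Group group
    using (∙-cancelˡ; ∙-cancelʳ; inverseˡ-unique; inverseʳ-unique; ε⁻¹≈ε; ⁻¹-injective; ⁻¹-anti-homo-∙)

  record GeneratingPair (p q r : ℕ) : Set where
    field
      x y       : Fin n
      generates : Generates G (x ∷ y ∷ [])
      x≢ε       : x ≢ ε
      y≢ε       : y ≢ ε
      xy≢ε      : x ∙ y ≢ ε
      xᵖ≡ε      : pow G x p ≡ ε
      yᵠ≡ε      : pow G y q ≡ ε
      xyʳ≡ε     : pow G (x ∙ y) r ≡ ε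

  private variable
    g u v : Fin n
    S T : List (Fin n)

  _∈⟨_⟩ : Fin n → List (Fin n) → Set
  g ∈⟨ S ⟩ = ⟨_⟩ G S g

  ⟨⟩-fst : u ∈⟨ u ∷ S ⟩
  ⟨⟩-fst = gen (here refl)

  ⟨⟩-snd : v ∈⟨ u ∷ v ∷ S ⟩
  ⟨⟩-snd = gen (there (here refl))

  ⟨⟩-mono : (∀ {g} → g ∈ S → g ∈⟨ T ⟩) → g ∈⟨ S ⟩ → g ∈⟨ T ⟩
  ⟨⟩-mono S⊆T (gen g∈S) = S⊆T g∈S
  ⟨⟩-mono S⊆T one       = one
  ⟨⟩-mono S⊆T (mul p q) = mul (⟨⟩-mono S⊆T p) (⟨⟩-mono S⊆T q)
  ⟨⟩-mono S⊆T (inv p)   = inv (⟨⟩-mono S⊆T p)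

  generates-via : u ∈⟨ T ⟩ → v ∈⟨ T ⟩ → Generates G (u ∷ v ∷ []) → Generates G T
  generates-via {T = T} u∈T v∈T gen-uv g = ⟨⟩-mono uv⊆T (gen-uv g)
    where
    uv⊆T : ∀ {g} → g ∈ _ ∷ _ ∷ [] → g ∈⟨ T ⟩
    uv⊆T (here refl)         = u∈T
    uv⊆T (there (here refl)) = v∈T

  ∙∙⁻¹ : ∀ u v → (u ∙ v) ∙ v ⁻¹ ≡ u
  ∙∙⁻¹ u v = trans (assoc u v (v ⁻¹)) (trans (cong (u ∙_) (inverseʳ v)) (identityʳ u))

  swap-generates : Generates G (u ∷ v ∷ []) → Generates G (v ∷ u ∷ [])
  swap-generates = generates-via ⟨⟩-snd ⟨⟩-fst

  ∙-generates : Generates G (u ∷ v ∷ []) → Generates G (u ∙ v ∷ v ∷ [])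
  ∙-generates {u} {v} = generates-via
    (subst (_∈⟨ u ∙ v ∷ v ∷ [] ⟩) (∙∙⁻¹ u v) (mul ⟨⟩-fst (inv ⟨⟩-snd))) ⟨⟩-snd

  ⁻¹-generates : Generates G (u ∷ v ∷ []) → Generates G (u ∷ v ⁻¹ ∷ [])
  ⁻¹-generates {u} {v} = generates-via ⟨⟩-fst
    (subst (_∈⟨ u ∷ v ⁻¹ ∷ [] ⟩) (sym (inverseʳ-unique (v ⁻¹) v (inverseˡ v))) (inv ⟨⟩-snd))

  module Noncyclic (noncyclic : ∀ g → ¬ Generates G (g ∷ [])) (gen-uv : Generates G (u ∷ v ∷ [])) where

    fst≢ε : u ≢ ε
    fst≢ε refl = noncyclic v (generates-via one ⟨⟩-fst gen-uv)

    snd≢ε : v ≢ ε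
    snd≢ε refl = noncyclic u (generates-via ⟨⟩-fst one gen-uv)

    ∙≢ε : u ∙ v ≢ ε
    ∙≢ε uv≡ε = noncyclic u (generates-via ⟨⟩-fst
      (subst (_∈⟨ u ∷ [] ⟩) (sym (inverseʳ-unique u v uv≡ε)) (inv ⟨⟩-fst)) gen-uv)

  pow-+ : ∀ x j k → pow G x (j + k) ≡ pow G x j ∙ pow G x k
  pow-+ x zero    k = sym (identityˡ _)
  pow-+ x (suc j) k = trans (cong (x ∙_) (pow-+ x j k)) (sym (assoc _ _ _))

  pow-sucʳ : ∀ x k → pow G x (suc k) ≡ pow G x k ∙ x
  pow-sucʳ x zero    = trans (identityʳ x) (sym (identityˡ x))
  pow-sucʳ x (suc k) = trans (cong (x ∙_) (pow-sucʳ x k)) (sym (assoc _ _ _))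

  pow-⁻¹ : ∀ x k → pow G (x ⁻¹) k ≡ pow G x k ⁻¹
  pow-⁻¹ x zero    = sym ε⁻¹≈ε
  pow-⁻¹ x (suc k) = begin
    x ⁻¹ ∙ pow G (x ⁻¹) k    ≡⟨ cong (x ⁻¹ ∙_) (pow-⁻¹ x k) ⟩
    x ⁻¹ ∙ pow G x k ⁻¹      ≡⟨ sym (⁻¹-anti-homo-∙ (pow G x k) x) ⟩
    (pow G x k ∙ x) ⁻¹       ≡⟨ cong _⁻¹ (sym (pow-sucʳ x k)) ⟩
    pow G x (suc k) ⁻¹       ∎
    where open ≡-Reasoning

  pow-∙-shift : ∀ x y k → y ∙ pow G (x ∙ y) k ≡ pow G (y ∙ x) k ∙ y
  pow-∙-shift x y zero    = trans (identityʳ y) (sym (identityˡ y))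
  pow-∙-shift x y (suc k) = begin
    y ∙ ((x ∙ y) ∙ pow G (x ∙ y) k)  ≡⟨ sym (assoc y (x ∙ y) _) ⟩
    (y ∙ (x ∙ y)) ∙ pow G (x ∙ y) k  ≡⟨ cong (_∙ pow G (x ∙ y) k) (sym (assoc y x y)) ⟩
    ((y ∙ x) ∙ y) ∙ pow G (x ∙ y) k  ≡⟨ assoc (y ∙ x) y _ ⟩
    (y ∙ x) ∙ (y ∙ pow G (x ∙ y) k)  ≡⟨ cong ((y ∙ x) ∙_) (pow-∙-shift x y k) ⟩
    (y ∙ x) ∙ (pow G (y ∙ x) k ∙ y)  ≡⟨ sym (assoc (y ∙ x) _ y) ⟩
    pow G (y ∙ x) (suc k) ∙ y        ∎
    where open ≡-Reasoning

  pow-vanishes : ∀ x → ∃[ m ] pow G x (suc m) ≡ ε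
  pow-vanishes x with pigeonhole (n<1+n n) (λ (i : Fin (suc n)) → pow G x (toℕ i))
  ... | i , j , i<j , xⁱ≡xʲ with m≤n⇒∃[o]m+o≡n i<j
  ... | d , i+1+d≡j = d , ∙-cancelˡ (pow G x (toℕ i)) _ _ (begin
    pow G x (toℕ i) ∙ pow G x (suc d)  ≡⟨ sym (pow-+ x (toℕ i) (suc d)) ⟩
    pow G x (toℕ i + suc d)            ≡⟨ cong (pow G x) (trans (+-suc (toℕ i) d) i+1+d≡j) ⟩
    pow G x (toℕ j)                    ≡⟨ sym xⁱ≡xʲ ⟩
    pow G x (toℕ i)                    ≡⟨ sym (identityʳ _) ⟩
    pow G x (toℕ i) ∙ ε                ∎)
    where open ≡-Reasoning

  order : ∀ x → ∃[ k ] OrderIs G x k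
  order x with pow-vanishes x
  ... | m , xᵐ⁺¹≡ε with least-witness (λ j → pow G x (suc j) ≟ ε) {m} xᵐ⁺¹≡ε
  ... | k , xᵏ⁺¹≡ε , below = suc k , s≤s z≤n , xᵏ⁺¹≡ε , λ where
    (suc j) _ j+1<k+1 → below j (≤-pred j+1<k+1)

  data OrderClass (x : Fin n) : Set where
    small : ∀ {p} → SmallPrime p → pow G x p ≡ ε → OrderClass x
    large : ∃[ k ] (OrderIs G x k × 4 ≤ k) → OrderClass x

  classify : ∀ x → x ≢ ε → OrderClass x
  classify x x≢ε with pow G x 2 ≟ ε | pow G x 3 ≟ ε
  ... | yes x²≡ε | _        = small two x²≡ε
  ... | no _     | yes x³≡ε = small three x³≡ε
  ... | no x²≢ε  | no x³≢ε  with order x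
  ... | k , o@(1≤k , xᵏ≡ε , _) = large (k , o , 4≤ k 1≤k xᵏ≡ε)
    where
    4≤ : ∀ k → 1 ≤ k → pow G x k ≡ ε → 4 ≤ k
    4≤ 1 _ x¹≡ε = contradiction (trans (sym (identityʳ x)) x¹≡ε) x≢ε
    4≤ 2 _ x²≡ε = contradiction x²≡ε x²≢ε
    4≤ 3 _ x³≡ε = contradiction x³≡ε x³≢ε
    4≤ (suc (suc (suc (suc k)))) _ _ = s≤s (s≤s (s≤s (s≤s z≤n)))

  swap : ∀ {p q r} → GeneratingPair p q r → GeneratingPair q p r
  swap {r = r} P = record
    { x = y ; y = x
    ; generates = swap-generates generates
    ; x≢ε = y≢ε ; y≢ε = x≢ε
    ; xy≢ε = λ yx≡ε → xy≢ε (trans (cong (x ∙_) (inverseˡ-unique y x yx≡ε)) (inverseʳ x))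
    ; xᵖ≡ε = yᵠ≡ε ; yᵠ≡ε = xᵖ≡ε
    ; xyʳ≡ε = ∙-cancelʳ y _ _ (begin
        pow G (y ∙ x) r ∙ y  ≡⟨ sym (pow-∙-shift x y r) ⟩
        y ∙ pow G (x ∙ y) r  ≡⟨ cong (y ∙_) xyʳ≡ε ⟩
        y ∙ ε                ≡⟨ identityʳ y ⟩
        y                    ≡⟨ sym (identityˡ y) ⟩
        ε ∙ y                ∎)
    }
    where
    open GeneratingPair P
    open ≡-Reasoning

  reverse : ∀ {p q r} → GeneratingPair p q r → GeneratingPair r q p
  reverse {p} {q} P = record
    { x = x ∙ y ; y = y ⁻¹
    ; generates = ⁻¹-generates (∙-generates generates)
    ; x≢ε = xy≢ε
    ; y≢ε = λ y⁻¹≡ε → y≢ε (⁻¹-injective (trans y⁻¹≡ε (sym ε⁻¹≈ε)))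
    ; xy≢ε = λ x≡ε → x≢ε (trans (sym (∙∙⁻¹ x y)) x≡ε)
    ; xᵖ≡ε = xyʳ≡ε
    ; yᵠ≡ε = trans (pow-⁻¹ y q) (trans (cong _⁻¹ yᵠ≡ε) ε⁻¹≈ε)
    ; xyʳ≡ε = subst (λ g → pow G g p ≡ ε) (sym (∙∙⁻¹ x y)) xᵖ≡ε
    }
    where open GeneratingPair P

  ≅-from-hom : {H : Set} {_⋆_ : H → H → H} (φ : H → Fin n) →
    (∀ h k → φ (h ⋆ k) ≡ φ h ∙ φ k) → (∀ g → ∃[ h ] φ h ≡ g) → (∀ h k → φ h ≡ φ k → h ≡ k) →
    G ≅ _⋆_
  ≅-from-hom {H} {_⋆_} φ φ-hom φ-surjective φ-injective = record
    { to = to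
    ; from = φ
    ; from∘to = φ∘to
    ; to∘from = λ h → φ-injective _ _ (φ∘to (φ h))
    ; hom = λ g g′ → φ-injective _ _ (begin
        φ (to (g ∙ g′))         ≡⟨ φ∘to (g ∙ g′) ⟩
        g ∙ g′                  ≡⟨ sym (cong₂ _∙_ (φ∘to g) (φ∘to g′)) ⟩
        φ (to g) ∙ φ (to g′)    ≡⟨ sym (φ-hom (to g) (to g′)) ⟩
        φ (to g ⋆ to g′)        ∎)
    }
    where
    open ≡-Reasoning
    to : Fin n → H
    to g = proj₁ (φ-surjective g)
    φ∘to : ∀ g → φ (to g) ≡ g
    φ∘to g = proj₂ (φ-surjective g)

module Evaluation {n : ℕ} (G : FinGroup n) (x y : Fin n) where
  open FinGroup G
  open IsGroup isGroup using (assoc; identityˡ; identityʳ)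

  ⟦_⟧ₗ : Letter → Fin n
  ⟦ A ⟧ₗ = x
  ⟦ B ⟧ₗ = y

  ⟦_⟧ : Word → Fin n
  ⟦ [] ⟧    = ε
  ⟦ c ∷ w ⟧ = ⟦ c ⟧ₗ ∙ ⟦ w ⟧

  ⟦++⟧ : ∀ u v → ⟦ u ++ v ⟧ ≡ ⟦ u ⟧ ∙ ⟦ v ⟧
  ⟦++⟧ []      v = sym (identityˡ _)
  ⟦++⟧ (c ∷ u) v = trans (cong (⟦ c ⟧ₗ ∙_) (⟦++⟧ u v)) (sym (assoc _ _ _))

  ⟦^⟧ : ∀ w k → ⟦ w ^ k ⟧ ≡ pow G ⟦ w ⟧ k
  ⟦^⟧ w zero    = refl
  ⟦^⟧ w (suc k) = trans (⟦++⟧ w (w ^ k)) (cong (⟦ w ⟧ ∙_) (⟦^⟧ w k))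

  Holds : Rule → Set
  Holds (l , r) = ⟦ l ⟧ ≡ ⟦ r ⟧

  Separated : Word × Word → Set
  Separated (u , v) = ⟦ u ⟧ ≢ ⟦ v ⟧

  private variable
    rs : List Rule

  rewritesAtHead-sound : All Holds rs → ∀ w → All (λ w′ → ⟦ w′ ⟧ ≡ ⟦ w ⟧) (rewritesAtHead rs w)
  rewritesAtHead-sound []                         w = []
  rewritesAtHead-sound {(l , r) ∷ rs} (l≈r ∷ ok) w with take (length l) w ≟ʷ l
  ... | no _       = rewritesAtHead-sound ok w
  ... | yes prefix = rewrite-eq ∷ rewritesAtHead-sound ok w
    where
    open ≡-Reasoning
    rest : Word
    rest = drop (length l) w
    rewrite-eq : ⟦ r ++ rest ⟧ ≡ ⟦ w ⟧
    rewrite-eq = begin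
      ⟦ r ++ rest ⟧                    ≡⟨ ⟦++⟧ r rest ⟩
      ⟦ r ⟧ ∙ ⟦ rest ⟧                 ≡⟨ cong (_∙ ⟦ rest ⟧) (sym l≈r) ⟩
      ⟦ l ⟧ ∙ ⟦ rest ⟧                 ≡⟨ cong (λ u → ⟦ u ⟧ ∙ ⟦ rest ⟧) (sym prefix) ⟩
      ⟦ take (length l) w ⟧ ∙ ⟦ rest ⟧ ≡⟨ sym (⟦++⟧ (take (length l) w) rest) ⟩
      ⟦ take (length l) w ++ rest ⟧    ≡⟨ cong ⟦_⟧ (take++drop≡id (length l) w) ⟩
      ⟦ w ⟧                            ∎

  rewrites-sound : All Holds rs → ∀ w → All (λ w′ → ⟦ w′ ⟧ ≡ ⟦ w ⟧) (rewrites rs w)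
  rewrites-sound ok []      = rewritesAtHead-sound ok []
  rewrites-sound ok (c ∷ w) = ++⁺ (rewritesAtHead-sound ok (c ∷ w))
                                  (map⁺ (All.map (cong (⟦ c ⟧ₗ ∙_)) (rewrites-sound ok w)))

  normaliseWithin-sound : All Holds rs → ∀ k w → ⟦ normaliseWithin k rs w ⟧ ≡ ⟦ w ⟧
  normaliseWithin-sound ok zero w = refl
  normaliseWithin-sound {rs} ok (suc k) w with rewrites rs w | rewrites-sound ok w
  ... | []     | _        = refl
  ... | w′ ∷ _ | w′≈w ∷ _ = trans (normaliseWithin-sound ok k w′) w′≈w

  normalise-sound : All Holds rs → ∀ w → ⟦ normalise rs w ⟧ ≡ ⟦ w ⟧
  normalise-sound ok = normaliseWithin-sound ok 32

  reduct-sound : All Holds rs → ∀ {w v} → Reduct rs w v → ⟦ v ⟧ ≡ ⟦ w ⟧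
  reduct-sound {rs} ok {w} {v} red with All.lookupAny (refl ∷ rewrites-sound ok w) red
  ... | u≈w , nf≡v = trans (cong ⟦_⟧ (sym nf≡v)) (trans (normalise-sound ok (Any.lookup red)) u≈w)

  extend-sound : All Holds rs → ∀ ds → Derives rs ds → All Holds (extend rs ds)
  extend-sound ok []                  _                      = ok
  extend-sound ok (((l , r) , w) ∷ ds) ((l↞w , r↞w) , valid) =
    extend-sound (++⁺ ok (trans (reduct-sound ok l↞w) (sym (reduct-sound ok r↞w)) ∷ [])) ds valid

  power-holds : ∀ w {g} k → ⟦ w ⟧ ≡ g → pow G g k ≡ ε → Holds (w ^ k , [])
  power-holds w k refl gᵏ≡ε = trans (⟦^⟧ w k) gᵏ≡ε

  ⟦a⟧ : ⟦ a ⟧ ≡ x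
  ⟦a⟧ = identityʳ x

  ⟦b⟧ : ⟦ b ⟧ ≡ y
  ⟦b⟧ = identityʳ y

  ⟦ab⟧ : ⟦ a · b ⟧ ≡ x ∙ y
  ⟦ab⟧ = cong (x ∙_) ⟦b⟧

  ⟦ba⟧ : ⟦ b · a ⟧ ≡ y ∙ x
  ⟦ba⟧ = cong (y ∙_) ⟦a⟧

  ⟦abb⟧ : ⟦ a · b · b ⟧ ≡ (x ∙ y) ∙ y
  ⟦abb⟧ = trans (cong (λ g → x ∙ (y ∙ g)) ⟦b⟧) (sym (assoc x y y))

Enumeration : Set → Set
Enumeration X = Σ (List X) λ xs → ∀ t → t ∈ xs

finᴱ : ∀ m → Enumeration (Fin m)
finᴱ m = allFin m , ∈-allFin

infixr 2 _×ᴱ_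

_×ᴱ_ : ∀ {X Y} → Enumeration X → Enumeration Y → Enumeration (X × Y)
(xs , xs-complete) ×ᴱ (ys , ys-complete) =
  cartesianProduct xs ys , λ (s , t) → ∈-cartesianProduct⁺ (xs-complete s) (ys-complete t)

letters : Enumeration Letter
letters = A ∷ B ∷ [] , λ where
  A → here refl
  B → there (here refl)

All⇒∀ : ∀ {X} {P : X → Set} (E : Enumeration X) → All P (proj₁ E) → ∀ t → P t
All⇒∀ (_ , complete) all t = All.lookup all (complete t)

-- H = ⟨generator A, generator B⟩ is presented by `relations`; together with the rules derived in
-- `completion` they form a confluent rewriting system whose irreducible words are `normalForms`.
record FiniteModel {H : Set} (_⋆_ : H → H → H) : Set where
  field
    e           : H
    generator   : Letter → H
    exponent    : ℕ  -- a multiple of the exponent of H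
    _≟ᴴ_        : DecidableEquality H
    enumeration : Enumeration H
    relations   : List Rule
    completion  : List (Rule × Word)
    normalForms : List Word
    separations : List (Word × Word)

  elements : List H
  elements = proj₁ enumeration

  rules : List Rule
  rules = extend relations completion

  power : H → ℕ → H
  power h zero    = e
  power h (suc k) = h ⋆ power h k

  inverse : H → H
  inverse h = power h (exponent ∸ 1)

  spell : Word → H
  spell []      = e
  spell (c ∷ w) = generator c ⋆ spell w

  -- [] is a junk value for an h that no word of normalForms spells; the certificate rules this out.
  normalWord : H → Word
  normalWord h = fromMaybe [] (find (λ w → spell w ≟ᴴ h) normalForms)

  conj : H → H → H
  conj u z = (u ⋆ z) ⋆ inverse u

  separator : Word × Word → H
  separator (u , v) = spell u ⋆ inverse (spell v)

  -- If so, every normal subgroup of H containing z contains a separator.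
  MeetsSeparator : H → Set
  MeetsSeparator z = Any (λ u → Any (λ s →
    conj u z ≡ separator s ⊎ conj u (z ⋆ z) ≡ separator s) separations) elements

  meetsSeparator? : ∀ z → Dec (MeetsSeparator z)
  meetsSeparator? z = Any.any? (λ u → Any.any? (λ s →
    (conj u z ≟ᴴ separator s) ⊎-dec (conj u (z ⋆ z) ≟ᴴ separator s)) separations) elements

record Certificate {H : Set} {_⋆_ : H → H → H} (M : FiniteModel _⋆_) : Set where
  open FiniteModel M
  field
    completion-valid  : Derives relations completion
    spell-normalWord  : ∀ h → spell (normalWord h) ≡ h
    normalWord-e      : normalWord e ≡ []
    normalise-step    : ∀ c h → normalise rules (c ∷ normalWord h) ≡ normalWord (generator c ⋆ h)
    identityˡ         : ∀ h → e ⋆ h ≡ h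
    assoc-generator   : ∀ c h k → (generator c ⋆ h) ⋆ k ≡ generator c ⋆ (h ⋆ k)
    inverseʳ          : ∀ h → h ⋆ inverse h ≡ e
    inverse-unique    : ∀ h k → h ⋆ inverse k ≡ e → h ≡ k
    normal-closure    : ∀ z → z ≡ e ⊎ MeetsSeparator z

module _ {H : Set} {_⋆_ : H → H → H} (M : FiniteModel _⋆_) where
  open FiniteModel M

  private
    Checks : Set
    Checks = Derives relations completion
           × All (λ h → spell (normalWord h) ≡ h) elements
           × normalWord e ≡ []
           × All (λ c → All (λ h →
               normalise rules (c ∷ normalWord h) ≡ normalWord (generator c ⋆ h)) elements) (proj₁ letters)
           × All (λ h → e ⋆ h ≡ h) elements
           × All (λ c → All (λ h → All (λ k →
               (generator c ⋆ h) ⋆ k ≡ generator c ⋆ (h ⋆ k)) elements) elements) (proj₁ letters)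
           × All (λ h → h ⋆ inverse h ≡ e) elements
           × All (λ h → All (λ k → h ⋆ inverse k ≡ e → h ≡ k) elements) elements
           × All (λ z → z ≡ e ⊎ MeetsSeparator z) elements

    checks? : Dec Checks
    checks? = derives? relations completion
      ×-dec All.all? (λ h → spell (normalWord h) ≟ᴴ h) elements
      ×-dec normalWord e ≟ʷ []
      ×-dec All.all? (λ c → All.all? (λ h →
              normalise rules (c ∷ normalWord h) ≟ʷ normalWord (generator c ⋆ h)) elements) (proj₁ letters)
      ×-dec All.all? (λ h → (e ⋆ h) ≟ᴴ h) elements
      ×-dec All.all? (λ c → All.all? (λ h → All.all? (λ k →
              ((generator c ⋆ h) ⋆ k) ≟ᴴ (generator c ⋆ (h ⋆ k))) elements) elements) (proj₁ letters)
      ×-dec All.all? (λ h → (h ⋆ inverse h) ≟ᴴ e) elements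
      ×-dec All.all? (λ h → All.all? (λ k →
              ((h ⋆ inverse k) ≟ᴴ e) →-dec (h ≟ᴴ k)) elements) elements
      ×-dec All.all? (λ z → (z ≟ᴴ e) ⊎-dec meetsSeparator? z) elements

  certify : True checks? → Certificate M
  certify valid with toWitness valid
  ... | c₁ , c₂ , c₃ , c₄ , c₅ , c₆ , c₇ , c₈ , c₉ = record
    { completion-valid = c₁
    ; spell-normalWord = ∀ᴴ c₂
    ; normalWord-e     = c₃
    ; normalise-step   = λ c → ∀ᴴ (All⇒∀ letters c₄ c)
    ; identityˡ        = ∀ᴴ c₅
    ; assoc-generator  = λ c h → ∀ᴴ (∀ᴴ (All⇒∀ letters c₆ c) h)
    ; inverseʳ         = ∀ᴴ c₇
    ; inverse-unique   = λ h → ∀ᴴ (∀ᴴ c₈ h)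
    ; normal-closure   = ∀ᴴ c₉
    }
    where
    ∀ᴴ : ∀ {P : H → Set} → All P elements → ∀ h → P h
    ∀ᴴ = All⇒∀ enumeration

module VonDyck {n : ℕ} (G : FinGroup n) (x y : Fin n)
  {H : Set} {_⋆_ : H → H → H} (M : FiniteModel _⋆_) (certificate : Certificate M) where

  open FinGroup G
  open IsGroup isGroup using (assoc; identityˡ; identityʳ; inverseʳ)
  open GroupTheory G using (group; _∈⟨_⟩; ≅-from-hom)
  open import Algebra.Properties.Group group using (inverseˡ-unique; inverseʳ-unique; ⁻¹-involutive)
  open Evaluation G x y
  open FiniteModel M
  open Certificate certificate renaming (inverseʳ to ⋆-inverseʳ; identityˡ to ⋆-identityˡ)
  open ≡-Reasoning

  module _ (relations-hold : All Holds relations) where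

    rules-hold : All Holds rules
    rules-hold = extend-sound relations-hold completion completion-valid

    φ : H → Fin n
    φ h = ⟦ normalWord h ⟧

    φ-e : φ e ≡ ε
    φ-e = cong ⟦_⟧ normalWord-e

    φ-generator⋆ : ∀ c h → φ (generator c ⋆ h) ≡ ⟦ c ⟧ₗ ∙ φ h
    φ-generator⋆ c h = begin
      ⟦ normalWord (generator c ⋆ h) ⟧       ≡⟨ cong ⟦_⟧ (sym (normalise-step c h)) ⟩
      ⟦ normalise rules (c ∷ normalWord h) ⟧ ≡⟨ normalise-sound rules-hold (c ∷ normalWord h) ⟩
      ⟦ c ⟧ₗ ∙ φ h                            ∎

    φ-spell : ∀ w → φ (spell w) ≡ ⟦ w ⟧
    φ-spell []      = φ-e
    φ-spell (c ∷ w) = trans (φ-generator⋆ c (spell w)) (cong (⟦ c ⟧ₗ ∙_) (φ-spell w))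

    spell-++ : ∀ u v → spell (u ++ v) ≡ spell u ⋆ spell v
    spell-++ []      v = sym (⋆-identityˡ (spell v))
    spell-++ (c ∷ u) v = trans (cong (generator c ⋆_) (spell-++ u v)) (sym (assoc-generator c _ _))

    φ-hom : ∀ h k → φ (h ⋆ k) ≡ φ h ∙ φ k
    φ-hom h k = begin
      φ (h ⋆ k)                     ≡⟨ cong φ (sym (cong₂ _⋆_ (spell-normalWord h) (spell-normalWord k))) ⟩
      φ (spell u ⋆ spell v)         ≡⟨ cong φ (sym (spell-++ u v)) ⟩
      φ (spell (u ++ v))            ≡⟨ φ-spell (u ++ v) ⟩
      ⟦ u ++ v ⟧                    ≡⟨ ⟦++⟧ u v ⟩
      φ h ∙ φ k                     ∎
      where
      u v : Word
      u = normalWord h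
      v = normalWord k

    φ-inverse : ∀ h → φ (inverse h) ≡ φ h ⁻¹
    φ-inverse h = inverseʳ-unique (φ h) _ (begin
      φ h ∙ φ (inverse h)   ≡⟨ sym (φ-hom h (inverse h)) ⟩
      φ (h ⋆ inverse h)     ≡⟨ cong φ (⋆-inverseʳ h) ⟩
      φ e                   ≡⟨ φ-e ⟩
      ε                     ∎)

    φ-surjective : Generates G (x ∷ y ∷ []) → ∀ g → ∃[ h ] φ h ≡ g
    φ-surjective generates g = preimage (generates g)
      where
      preimage : ∀ {g} → g ∈⟨ x ∷ y ∷ [] ⟩ → ∃[ h ] φ h ≡ g
      preimage (gen (here refl))         = spell a , trans (φ-spell a) ⟦a⟧
      preimage (gen (there (here refl))) = spell b , trans (φ-spell b) ⟦b⟧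
      preimage one                       = e , φ-e
      preimage (mul p q) with preimage p | preimage q
      ... | h , refl | k , refl = h ⋆ k , φ-hom h k
      preimage (inv p) with preimage p
      ... | h , refl = inverse h , φ-inverse h

    φ-square : ∀ z → φ z ≡ ε → φ (z ⋆ z) ≡ ε
    φ-square z φz≡ε = trans (φ-hom z z) (trans (cong₂ _∙_ φz≡ε φz≡ε) (identityʳ ε))

    φ-conj : ∀ u z → φ z ≡ ε → φ (conj u z) ≡ ε
    φ-conj u z φz≡ε = begin
      φ ((u ⋆ z) ⋆ inverse u)        ≡⟨ φ-hom (u ⋆ z) (inverse u) ⟩
      φ (u ⋆ z) ∙ φ (inverse u)      ≡⟨ cong₂ _∙_ (φ-hom u z) (φ-inverse u) ⟩
      (φ u ∙ φ z) ∙ φ u ⁻¹          ≡⟨ cong (λ g → (φ u ∙ g) ∙ φ u ⁻¹) φz≡ε ⟩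
      (φ u ∙ ε) ∙ φ u ⁻¹            ≡⟨ cong (_∙ φ u ⁻¹) (identityʳ (φ u)) ⟩
      φ u ∙ φ u ⁻¹                  ≡⟨ inverseʳ (φ u) ⟩
      ε                              ∎

    φ-conj-vanishes : ∀ u z → φ z ≡ ε → ∀ {t} → conj u z ≡ t ⊎ conj u (z ⋆ z) ≡ t → φ t ≡ ε
    φ-conj-vanishes u z φz≡ε (inj₁ refl) = φ-conj u z φz≡ε
    φ-conj-vanishes u z φz≡ε (inj₂ refl) = φ-conj u (z ⋆ z) (φ-square z φz≡ε)

    φ-separator : ∀ u v → φ (separator (u , v)) ≡ ⟦ u ⟧ ∙ ⟦ v ⟧ ⁻¹
    φ-separator u v = begin
      φ (spell u ⋆ inverse (spell v))       ≡⟨ φ-hom (spell u) _ ⟩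
      φ (spell u) ∙ φ (inverse (spell v))   ≡⟨ cong₂ _∙_ (φ-spell u) (φ-inverse (spell v)) ⟩
      ⟦ u ⟧ ∙ φ (spell v) ⁻¹                ≡⟨ cong (λ g → ⟦ u ⟧ ∙ g ⁻¹) (φ-spell v) ⟩
      ⟦ u ⟧ ∙ ⟦ v ⟧ ⁻¹                      ∎

    separator≢ε : ∀ s → Separated s → φ (separator s) ≢ ε
    separator≢ε (u , v) u≢v φs≡ε = u≢v (trans
      (inverseˡ-unique ⟦ u ⟧ (⟦ v ⟧ ⁻¹) (trans (sym (φ-separator u v)) φs≡ε))
      (⁻¹-involutive ⟦ v ⟧))

    module _ (separated : All Separated separations) where

      φ-kernel : ∀ z → φ z ≡ ε → z ≡ e
      φ-kernel z φz≡ε with normal-closure z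
      ... | inj₁ z≡e  = z≡e
      ... | inj₂ meets with Any.satisfied meets
      ... | u , hit with All.lookupAny separated hit
      ... | separated-s , conj≡s =
        contradiction (φ-conj-vanishes u z φz≡ε conj≡s) (separator≢ε (Any.lookup hit) separated-s)

      φ-injective : ∀ h k → φ h ≡ φ k → h ≡ k
      φ-injective h k φh≡φk = inverse-unique h k (φ-kernel (h ⋆ inverse k) (begin
        φ (h ⋆ inverse k)   ≡⟨ φ-hom h (inverse k) ⟩
        φ h ∙ φ (inverse k) ≡⟨ cong₂ _∙_ φh≡φk (φ-inverse k) ⟩
        φ k ∙ φ k ⁻¹        ≡⟨ inverseʳ (φ k) ⟩
        ε                   ∎))

      ≅-model : Generates G (x ∷ y ∷ []) → G ≅ _⋆_
      ≅-model generates = ≅-from-hom φ φ-hom (φ-surjective generates) φ-injective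

triangleRelations : ℕ → ℕ → ℕ → List Rule
triangleRelations p q r = (a ^ p , []) ∷ (b ^ q , []) ∷ ((a · b) ^ r , []) ∷ []

triangleSeparations : List (Word × Word)
triangleSeparations = (a , []) ∷ (b , []) ∷ (a · b , []) ∷ []

-- The completions were found by Knuth–Bendix completion in shortlex order with a < b.
c2²-model : FiniteModel C2²
c2²-model = record
  { e           = # 0 , # 0
  ; generator   = λ { A → # 1 , # 0 ; B → # 0 , # 1 }
  ; exponent    = 2
  ; _≟ᴴ_        = ≡-dec _≟_ _≟_
  ; enumeration = finᴱ 2 ×ᴱ finᴱ 2
  ; relations   = triangleRelations 2 2 2
  ; separations = triangleSeparations
  ; completion  =
        ((b · a · b , a) , a · a · b · a · b)
      ∷ ((b · a , a · b) , b · b · a · b)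
      ∷ []
  ; normalForms =
      [] ∷ a ∷ b ∷ a · b ∷ []
  }

c2²-certificate : Certificate c2²-model
c2²-certificate = certify c2²-model tt

d6-model : FiniteModel D6
d6-model = record
  { e           = # 0 , # 0
  ; generator   = λ { A → # 0 , # 1 ; B → # 1 , # 1 }
  ; exponent    = 6
  ; _≟ᴴ_        = ≡-dec _≟_ _≟_
  ; enumeration = finᴱ 3 ×ᴱ finᴱ 2
  ; relations   = triangleRelations 2 2 3
  ; separations = triangleSeparations
  ; completion  =
        ((b · a · b · a · b , a) , a · a · b · a · b · a · b)
      ∷ ((a · b · a · b , b · a) , b · b · a · b · a · b)
      ∷ ((b · a · b , a · b · a) , a · a · b · a · b)
      ∷ []
  ; normalForms =
      [] ∷ a ∷ b ∷ a · b ∷ b · a ∷ a · b · a ∷ []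
  }

d6-certificate : Certificate d6-model
d6-certificate = certify d6-model tt

a4-model : FiniteModel A4
a4-model = record
  { e           = (# 0 , # 0) , # 0
  ; generator   = λ { A → (# 1 , # 0) , # 0 ; B → (# 0 , # 0) , # 1 }
  ; exponent    = 6
  ; _≟ᴴ_        = ≡-dec (≡-dec _≟_ _≟_) _≟_
  ; enumeration = (finᴱ 2 ×ᴱ finᴱ 2) ×ᴱ finᴱ 3
  ; relations   = triangleRelations 2 3 3
  ; separations = triangleSeparations
  ; completion  =
        ((b · a · b · a · b , a) , a · a · b · a · b · a · b)
      ∷ ((a · b · a · b , b · b · a) , b · b · b · a · b · a · b)
      ∷ ((a · b · b · a , b · a · b) , a · a · b · a · b)
      ∷ ((b · a · b · a , a · b · b) , b · a · b · a · b · b · b)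
      ∷ ((b · b · a · b · b , a · b · a) , b · b · b · a · b · a)
      ∷ []
  ; normalForms =
      [] ∷ a ∷ b ∷ a · b ∷ b · a ∷ b · b ∷ a · b · a ∷ a · b · b ∷ b · a · b ∷ b · b · a ∷ b · a · b · b ∷
      b · b · a · b ∷ []
  }

a4-certificate : Certificate a4-model
a4-certificate = certify a4-model tt

c3²-model : FiniteModel C3²
c3²-model = record
  { e           = # 0 , # 0
  ; generator   = λ { A → # 1 , # 0 ; B → # 0 , # 1 }
  ; exponent    = 3
  ; _≟ᴴ_        = ≡-dec _≟_ _≟_
  ; enumeration = finᴱ 3 ×ᴱ finᴱ 3
  ; relations   = (a ^ 3 , []) ∷ (b ^ 3 , []) ∷ (b · a , a · b) ∷ []
  ; separations = (a , []) ∷ (b , []) ∷ (a · b , []) ∷ (a · b · b , []) ∷ []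
  ; completion  =
      []
  ; normalForms =
      [] ∷ a ∷ b ∷ a · a ∷ a · b ∷ b · b ∷ a · a · b ∷ a · b · b ∷ a · a · b · b ∷ []
  }

c3²-certificate : Certificate c3²-model
c3²-certificate = certify c3²-model tt

heis3-model : FiniteModel Heis3
heis3-model = record
  { e           = # 0 , # 0 , # 0
  ; generator   = λ { A → # 1 , # 0 , # 0 ; B → # 0 , # 1 , # 0 }
  ; exponent    = 3
  ; _≟ᴴ_        = ≡-dec _≟_ (≡-dec _≟_ _≟_)
  ; enumeration = finᴱ 3 ×ᴱ finᴱ 3 ×ᴱ finᴱ 3
  ; relations   = (a ^ 3 , []) ∷ (b ^ 3 , []) ∷ ((a · b) ^ 3 , []) ∷ ((a · b · b) ^ 3 , []) ∷ []
  ; separations = (a , []) ∷ (b , []) ∷ (a · b , []) ∷ (a · b · b , []) ∷ (a · b , b · a) ∷ []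
  ; completion  =
        ((b · a · b · a · b , a · a) , a · a · a · b · a · b · a · b)
      ∷ ((b · b · a · b · b · a · b · b , a · a) , a · a · a · b · b · a · b · b · a · b · b)
      ∷ ((b · b · a · a , a · b · a · b) , b · b · b · a · b · a · b)
      ∷ ((a · b · b · a · b · b , b · a · a) , b · b · b · a · b · b · a · b · b)
      ∷ ((b · b · a · b · b , a · a · b · a · a) , a · a · a · b · b · a · b · b)
      ∷ ((b · a · a · b · a · a , a · b · b) , b · b · b · a · b · b)
      ∷ ((a · b · a · a · b · a · b , b · a · b · b) , b · b · b · b · a · b · b)
      ∷ ((b · a · a · b · a · b , a · a · b · a · b · b) , a · a · a · b · a · a · b · a · b)
      ∷ ((a · b · a · b · a , b · b) , a · b · a · b · a · b · b · b)
      ∷ ((b · a · b · a , a · a · b · b) , a · a · a · b · a · b · a)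
      ∷ ((a · a · b · a · a · b , b · b · a) , b · b · a · a · b · a · b · a · b)
      ∷ ((b · a · a · b , a · b · b · a) , a · a · a · b · a · a · b)
      ∷ ((a · a · b · a · b · b · a , b · a · b · b) , b · b · a · a · b · a · a)
      ∷ ((b · a · b · b · a , a · b · a · b · b) , a · a · a · b · a · b · b · a)
      ∷ []
  ; normalForms =
      [] ∷ a ∷ b ∷ a · a ∷ a · b ∷ b · a ∷ b · b ∷ a · a · b ∷ a · b · a ∷ a · b · b ∷ b · a · a ∷
      b · a · b ∷ b · b · a ∷ a · a · b · a ∷ a · a · b · b ∷ a · b · a · a ∷ a · b · a · b ∷ a · b · b · a ∷
      b · a · b · b ∷ b · b · a · b ∷ a · a · b · a · a ∷ a · a · b · a · b ∷ a · a · b · b · a ∷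
      a · b · a · b · b ∷ a · b · b · a · b ∷ a · a · b · a · b · b ∷ a · a · b · b · a · b ∷ []
  }

heis3-certificate : Certificate heis3-model
heis3-certificate = certify heis3-model tt

module Classification {n : ℕ} (G : FinGroup n) where
  open FinGroup G
  open IsGroup isGroup using (assoc; identityʳ)
  open GroupTheory G

  LargeGenerator : Set
  LargeGenerator = ∃[ x ] ∃[ y ] (Generates G (x ∷ y ∷ []) × ∃[ k ] (OrderIs G x k × 4 ≤ k))

  Exceptional : Set
  Exceptional = G ≅ C2² ⊎ G ≅ C3² ⊎ G ≅ D6 ⊎ G ≅ A4 ⊎ G ≅ Heis3

  module Triangle {p q r} (P : GeneratingPair p q r) where
    open GeneratingPair P public
    open Evaluation G x y public

    triangle-holds : All Holds (triangleRelations p q r)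
    triangle-holds =
        power-holds a p ⟦a⟧ xᵖ≡ε
      ∷ power-holds b q ⟦b⟧ yᵠ≡ε
      ∷ power-holds (a · b) r ⟦ab⟧ xyʳ≡ε
      ∷ []

    triangle-separated : All Separated triangleSeparations
    triangle-separated = x≢ε ∘ trans (sym ⟦a⟧) ∷ y≢ε ∘ trans (sym ⟦b⟧) ∷ xy≢ε ∘ trans (sym ⟦ab⟧) ∷ []

  ≅C2² : GeneratingPair 2 2 2 → G ≅ C2²
  ≅C2² P = VonDyck.≅-model G x y c2²-model c2²-certificate triangle-holds triangle-separated generates
    where open Triangle P

  ≅D6 : GeneratingPair 2 2 3 → G ≅ D6
  ≅D6 P = VonDyck.≅-model G x y d6-model d6-certificate triangle-holds triangle-separated generates
    where open Triangle P

  ≅A4 : GeneratingPair 2 3 3 → G ≅ A4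
  ≅A4 P = VonDyck.≅-model G x y a4-model a4-certificate triangle-holds triangle-separated generates
    where open Triangle P

  module Type333 (P : GeneratingPair 3 3 3) where
    open Triangle P

    xyy-generates : Generates G ((x ∙ y) ∙ y ∷ y ∷ [])
    xyy-generates = ∙-generates (∙-generates generates)

    xyy∙y≡x : ((x ∙ y) ∙ y) ∙ y ≡ x
    xyy∙y≡x = begin
      ((x ∙ y) ∙ y) ∙ y    ≡⟨ assoc (x ∙ y) y y ⟩
      (x ∙ y) ∙ (y ∙ y)    ≡⟨ assoc x y (y ∙ y) ⟩
      x ∙ (y ∙ (y ∙ y))    ≡⟨ cong (λ g → x ∙ (y ∙ (y ∙ g))) (sym (identityʳ y)) ⟩
      x ∙ pow G y 3        ≡⟨ cong (x ∙_) yᵠ≡ε ⟩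
      x ∙ ε                ≡⟨ identityʳ x ⟩
      x                    ∎
      where open ≡-Reasoning

    xyy-pair : (x ∙ y) ∙ y ≢ ε → pow G ((x ∙ y) ∙ y) 2 ≡ ε → GeneratingPair 2 3 3
    xyy-pair xyy≢ε xyy²≡ε = record
      { x = (x ∙ y) ∙ y ; y = y ; generates = xyy-generates
      ; x≢ε = xyy≢ε ; y≢ε = y≢ε ; xy≢ε = x≢ε ∘ trans (sym xyy∙y≡x)
      ; xᵖ≡ε = xyy²≡ε ; yᵠ≡ε = yᵠ≡ε ; xyʳ≡ε = subst (λ g → pow G g 3 ≡ ε) (sym xyy∙y≡x) xᵖ≡ε
      }

    ≅C3² : (x ∙ y) ∙ y ≢ ε → y ∙ x ≡ x ∙ y → G ≅ C3²
    ≅C3² xyy≢ε yx≡xy = VonDyck.≅-model G x y c3²-model c3²-certificate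
      ( power-holds a 3 ⟦a⟧ xᵖ≡ε
      ∷ power-holds b 3 ⟦b⟧ yᵠ≡ε
      ∷ trans ⟦ba⟧ (trans yx≡xy (sym ⟦ab⟧))
      ∷ [])
      ( x≢ε ∘ trans (sym ⟦a⟧)
      ∷ y≢ε ∘ trans (sym ⟦b⟧)
      ∷ xy≢ε ∘ trans (sym ⟦ab⟧)
      ∷ xyy≢ε ∘ trans (sym ⟦abb⟧)
      ∷ [])
      generates

    ≅Heis3 : (x ∙ y) ∙ y ≢ ε → pow G ((x ∙ y) ∙ y) 3 ≡ ε → x ∙ y ≢ y ∙ x → G ≅ Heis3
    ≅Heis3 xyy≢ε xyy³≡ε xy≢yx = VonDyck.≅-model G x y heis3-model heis3-certificate
      ( power-holds a 3 ⟦a⟧ xᵖ≡ε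
      ∷ power-holds b 3 ⟦b⟧ yᵠ≡ε
      ∷ power-holds (a · b) 3 ⟦ab⟧ xyʳ≡ε
      ∷ power-holds (a · b · b) 3 ⟦abb⟧ xyy³≡ε
      ∷ [])
      ( x≢ε ∘ trans (sym ⟦a⟧)
      ∷ y≢ε ∘ trans (sym ⟦b⟧)
      ∷ xy≢ε ∘ trans (sym ⟦ab⟧)
      ∷ xyy≢ε ∘ trans (sym ⟦abb⟧)
      ∷ (λ ab≡ba → xy≢yx (trans (sym ⟦ab⟧) (trans ab≡ba ⟦ba⟧)))
      ∷ [])
      generates

  Conclusion : Set
  Conclusion = LargeGenerator ⊎ Exceptional

  module _ (noncyclic : ∀ g → ¬ Generates G (g ∷ [])) where

    viaD6 : GeneratingPair 2 2 3 → Conclusion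
    viaD6 P = inj₂ (inj₂ (inj₂ (inj₁ (≅D6 P))))

    viaA4 : GeneratingPair 2 3 3 → Conclusion
    viaA4 P = inj₂ (inj₂ (inj₂ (inj₂ (inj₁ (≅A4 P)))))

    module _ (P : GeneratingPair 3 3 3) where
      open GeneratingPair P
      open Type333 P using (xyy-generates; xyy-pair; ≅C3²; ≅Heis3)

      private
        xyy≢ε : (x ∙ y) ∙ y ≢ ε
        xyy≢ε = Noncyclic.∙≢ε noncyclic (∙-generates generates)

      viaType333 : Conclusion
      viaType333 with classify ((x ∙ y) ∙ y) xyy≢ε
      ... | large o            = inj₁ (_ , _ , xyy-generates , o)
      ... | small two xyy²≡ε   = viaA4 (xyy-pair xyy≢ε xyy²≡ε)
      ... | small three xyy³≡ε with (y ∙ x) ≟ (x ∙ y)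
      ...   | yes yx≡xy = inj₂ (inj₂ (inj₁ (≅C3² xyy≢ε yx≡xy)))
      ...   | no yx≢xy  = inj₂ (inj₂ (inj₂ (inj₂ (inj₂ (≅Heis3 xyy≢ε xyy³≡ε (yx≢xy ∘ sym))))))

    fromType : ∀ {p q r} → SmallPrime p → SmallPrime q → SmallPrime r → GeneratingPair p q r → Conclusion
    fromType two   two   two   P = inj₂ (inj₁ (≅C2² P))
    fromType two   two   three P = viaD6 P
    fromType two   three two   P = viaD6 (reverse (swap P))
    fromType three two   two   P = viaD6 (reverse P)
    fromType two   three three P = viaA4 P
    fromType three two   three P = viaA4 (swap P)
    fromType three three two   P = viaA4 (reverse P)
    fromType three three three P = viaType333 P

    module _ {x y} (generates : Generates G (x ∷ y ∷ [])) where
      open Noncyclic noncyclic generates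

      fromPair : Conclusion
      fromPair with classify x fst≢ε | classify y snd≢ε | classify (x ∙ y) ∙≢ε
      ... | large o | _       | _       = inj₁ (x , y , generates , o)
      ... | _       | large o | _       = inj₁ (y , x , swap-generates generates , o)
      ... | _       | _       | large o = inj₁ (x ∙ y , y , ∙-generates generates , o)
      ... | small p xᵖ≡ε | small q yᵠ≡ε | small r xyʳ≡ε = fromType p q r (record
        { x = x ; y = y ; generates = generates
        ; x≢ε = fst≢ε ; y≢ε = snd≢ε ; xy≢ε = ∙≢ε
        ; xᵖ≡ε = xᵖ≡ε ; yᵠ≡ε = yᵠ≡ε ; xyʳ≡ε = xyʳ≡ε
        })

lemma4p1 : (n : ℕ) (G : FinGroup n) → RankIs G 2 →
    (∃[ x ] ∃[ y ] (Generates G (x ∷ y ∷ []) × ∃[ k ] (OrderIs G x k × 4 ≤ k)))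
    ⊎ (G ≅ C2² ⊎ G ≅ C3² ⊎ G ≅ D6 ⊎ G ≅ A4 ⊎ G ≅ Heis3)
lemma4p1 n G ((_ ∷ _ ∷ [] , refl , generates) , minimal) =
  Classification.fromPair G noncyclic generates
  where
  noncyclic : ∀ g → ¬ Generates G (g ∷ [])
  noncyclic g = minimal (g ∷ []) ≤-refl
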